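{- Fix a positive integer $m'$. For each infinite sequence $d=(d_k)_{k\ge 1}$ with $d_k\in\{0,1\}$ define another sequence $d'=(d'_k)_{k\ge1}=T(d)$ by \begin{equation*} d'_{m'i+j}:= \begin{cases} 1-d_{m'i+j}&\text{for } i=0,2,4,\ldots \text{ and } j=1,\ldots,m',\\ d_{m'i+j}&\text{for } i=1,3,5,\ldots \text{ and } j=1,\ldots,m'. \end{cases} \end{equation*} Then $d$ is universal if and only if $d'$ is universal.
   Context: A sequence of zeroes and ones is called universal if it contains every finite block of zeroes and ones, i.e. for every finite word $b_1\ldots b_r$ with $b_s\in\{0,1\}$ there is an index $t\ge 0$ with $d_{t+s}=b_s$ for $s=1,\ldots,r$. -}

module Defs where

open import Data.Nat using (ℕ; zero; suc; _+_; _*_; _/_; _<_; _≤_; NonZero)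
open import Data.Nat.Properties using ()
open import Data.Bool using (Bool; true; false; not; if_then_else_)
open import Data.List using (List; length; lookup)
open import Data.Fin using (Fin; toℕ)
open import Data.Product using (∃-syntax)
open import Relation.Binary.PropositionalEquality using (_≡_)

-- A 0/1 sequence (d_k)_{k ≥ 1}, encoded as a function ℕ → Bool
-- (false = 0, true = 1).  The value at index 0 is irrelevant.
Seq : Set
Seq = ℕ → Bool

-- d is universal: for every finite word b_1 … b_r there is t ≥ 0 with
-- d_{t+s} = b_s for s = 1, …, r.  (Fin (length w) index s' stands for s = s'+1.)
Universal : Seq → Set
Universal d = (w : List Bool) → ∃[ t ] ((s : Fin (length w)) → d (t + suc (toℕ s)) ≡ lookup w s)

even : ℕ → Bool
even zero = true
even (suc n) = not (even n)

-- The transform T for block length m' ≥ 1: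
-- for k = m' i + j with j ∈ {1,…,m'} (i.e. i = (k-1) / m'),
-- d'_k = 1 - d_k if i is even, d'_k = d_k if i is odd.
T : (m' : ℕ) → .{{NonZero m'}} → Seq → Seq
T m' d zero = d zero
T m' d (suc k) = if even (k / m') then not (d (suc k)) else d (suc k)

module Submission where

-- Write the transform as a mask: T d flips d at position
-- k+1 exactly when the "flip pattern" F k = even (k / m') is true, and F is
-- periodic with period M = 2m'.  We prove the general statement that xoring a
-- universal sequence with ANY periodic mask p (period M > 0) gives a universal
-- sequence.  To find a word b_1 … b_r in the masked sequence, pick
-- L = 1 + r·M and look in d for the word of length (M+1)·L whose k-th letter is
-- b_{k mod L} pre-flipped by p (k mod L).  If it occurs at t, then since
-- L ≡ 1 (mod M) one of the shifts t + i·L with i ≤ M is a multiple of M; at that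
-- shift the mask is aligned with the pre-flipping, the two flips cancel, and
-- b_1 … b_r appears in the masked sequence.  Masking is an involution, so the
-- implication reverses and universality of d and T d are equivalent.

open import Defs
open import Data.Nat using (ℕ; NonZero; zero; suc; _+_; _*_; _/_; _%_; _<_; _≤_; _∸_; s≤s)
open import Data.Nat.Properties
open import Data.Nat.DivMod using (m≡m%n+[m/n]*n; m%n<n; [m+kn]%n≡m%n; m<n⇒m%n≡m; +-distrib-/-∣ʳ; m*n/n≡m)
open import Data.Nat.Divisibility using (_∣_; divides; ∣-reflexive; ∣m∣n⇒∣m+n; n∣m*n)
open import Data.Nat.Tactic.RingSolver using (solve-∀)
open import Data.Bool using (Bool; true; false; not; if_then_else_)
open import Data.Bool.Properties using (not-involutive)
open import Data.List using (List; []; _∷_; length; lookup; tabulate)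
open import Data.List.Properties using (length-tabulate; lookup-tabulate)
open import Data.Fin using (Fin; toℕ; fromℕ<; cast) renaming (zero to fzero; suc to fsuc)
open import Data.Fin.Properties using (toℕ-cast; toℕ-fromℕ<; toℕ<n)
open import Data.Product using (∃-syntax; _,_; proj₁; proj₂; _×_)
open import Function using (_∘_)
open import Function.Bundles using (_⇔_; mk⇔; module Equivalence)
open import Relation.Binary.PropositionalEquality

Universalᶠ : Seq → Set
Universalᶠ d = (r : ℕ) (f : ℕ → Bool) → ∃[ t ] ((s : ℕ) → s < r → d (t + suc s) ≡ f s)

Universal⇒Universalᶠ : ∀ d → Universal d → Universalᶠ d
Universal⇒Universalᶠ d univ r f = t , matches
  where
  w : List Bool
  w = tabulate {n = r} (f ∘ toℕ)

  t : ℕ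
  t = proj₁ (univ w)

  index : ∀ {s} → s < r → Fin (length w)
  index s<r = cast (sym (length-tabulate (f ∘ toℕ))) (fromℕ< s<r)

  matches : (s : ℕ) → s < r → d (t + suc s) ≡ f s
  matches s s<r = begin
    d (t + suc s)                     ≡⟨ cong (λ k → d (t + suc k)) (sym (trans (toℕ-cast _ _) (toℕ-fromℕ< s<r))) ⟩
    d (t + suc (toℕ (index s<r)))     ≡⟨ proj₂ (univ w) (index s<r) ⟩
    lookup w (index s<r)              ≡⟨ lookup-tabulate (f ∘ toℕ) (fromℕ< s<r) ⟩
    f (toℕ (fromℕ< s<r))              ≡⟨ cong f (toℕ-fromℕ< s<r) ⟩
    f s                               ∎
    where open ≡-Reasoning

-- List lookup extended to all of ℕ (with an arbitrary value past the end),
-- so that a list can be read as a word function.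
lookupℕ : List Bool → ℕ → Bool
lookupℕ []       _       = false
lookupℕ (x ∷ xs) zero    = x
lookupℕ (x ∷ xs) (suc n) = lookupℕ xs n

lookupℕ-toℕ : ∀ w (s : Fin (length w)) → lookupℕ w (toℕ s) ≡ lookup w s
lookupℕ-toℕ (x ∷ w) fzero    = refl
lookupℕ-toℕ (x ∷ w) (fsuc s) = lookupℕ-toℕ w s

Universalᶠ⇒Universal : ∀ d → Universalᶠ d → Universal d
Universalᶠ⇒Universal d univ w =
  let (t , hit) = univ (length w) (lookupℕ w)
  in t , λ s → trans (hit (toℕ s) (toℕ<n s)) (lookupℕ-toℕ w s)

Universal-resp : ∀ {d e} → (∀ k → d k ≡ e k) → Universal d → Universal e
Universal-resp d≗e univ w =
  let (t , hit) = univ w in t , λ s → trans (sym (d≗e _)) (hit s)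

flipIf : Bool → Bool → Bool
flipIf b x = if b then not x else x

flipIf-involutive : ∀ b x → flipIf b (flipIf b x) ≡ x
flipIf-involutive true  x = not-involutive x
flipIf-involutive false x = refl

mask : (ℕ → Bool) → Seq → Seq
mask p d zero    = d zero
mask p d (suc k) = flipIf (p k) (d (suc k))

mask-involutive : ∀ p d k → mask p (mask p d) k ≡ d k
mask-involutive p d zero    = refl
mask-involutive p d (suc k) = flipIf-involutive (p k) (d (suc k))

module PeriodicMask (M : ℕ) .{{_ : NonZero M}} (p : ℕ → Bool)
                    (periodic : ∀ k → p (k + M) ≡ p k) where

  periodic-∣ : ∀ {n} s → M ∣ n → p (n + s) ≡ p s
  periodic-∣ s (divides q refl) = multiple q
    where
    shift : ∀ a b s → a + b + s ≡ (b + s) + a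
    shift = solve-∀

    multiple : ∀ q → p (q * M + s) ≡ p s
    multiple zero    = refl
    multiple (suc q) = trans (cong p (shift M (q * M) s)) (trans (periodic (q * M + s)) (multiple q))

  -- Since 1 + c·M ≡ 1 (mod M), the shifts t + i·(1 + c·M) with i ≤ M run
  -- through all residues mod M; i = M - (t mod M) gives a multiple of M.
  alignment : ∀ t c → ∃[ i ] (i ≤ M × M ∣ t + i * suc (c * M))
  alignment t c = i , m∸n≤m M a , subst (M ∣_) (sym regroup) M∣regrouped
    where
    a b i : ℕ
    a = t % M
    b = t / M
    i = M ∸ a

    rearrange : ∀ a b i c M → a + b * M + i * suc (c * M) ≡ (a + i) + (b * M + i * c * M)
    rearrange = solve-∀

    regroup : t + i * suc (c * M) ≡ (a + i) + (b * M + i * c * M)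
    regroup = trans (cong (_+ i * suc (c * M)) (m≡m%n+[m/n]*n t M)) (rearrange a b i c M)

    M∣regrouped : M ∣ (a + i) + (b * M + i * c * M)
    M∣regrouped = ∣m∣n⇒∣m+n (∣-reflexive (sym (m+[n∸m]≡n (<⇒≤ (m%n<n t M)))))
                            (∣m∣n⇒∣m+n (n∣m*n b) (n∣m*n (i * c)))

  mask-universalᶠ : ∀ d → Universalᶠ d → Universalᶠ (mask p d)
  mask-universalᶠ d univ r f = t + i * L , matches
    where
    -- L is the period of the search word; L > r and L ≡ 1 (mod M).
    L : ℕ
    L = suc (r * M)

    r<L : r < L
    r<L = s≤s (m≤m*n r M)

    W : ℕ → Bool
    W k = flipIf (p (k % L)) (f (k % L))

    t : ℕ
    t = proj₁ (univ (suc M * L) W)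

    i : ℕ
    i = proj₁ (alignment t r)

    i≤M : i ≤ M
    i≤M = proj₁ (proj₂ (alignment t r))

    aligned : M ∣ t + i * L
    aligned = proj₂ (proj₂ (alignment t r))

    inside : ∀ s → s < r → i * L + s < suc M * L
    inside s s<r = begin-strict
      i * L + s  <⟨ +-monoʳ-< (i * L) (<-trans s<r r<L) ⟩
      i * L + L  ≡⟨ +-comm (i * L) L ⟩
      L + i * L  ≤⟨ +-monoʳ-≤ L (*-monoˡ-≤ L i≤M) ⟩
      suc M * L  ∎
      where open ≤-Reasoning

    W-copy : ∀ s → s < r → W (i * L + s) ≡ flipIf (p s) (f s)
    W-copy s s<r = cong (λ k → flipIf (p k) (f k)) reduce
      where
      reduce : (i * L + s) % L ≡ s
      reduce = trans (cong (_% L) (+-comm (i * L) s))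
                     (trans ([m+kn]%n≡m%n s i L) (m<n⇒m%n≡m (<-trans s<r r<L)))

    regroup : ∀ t x s → suc (t + x + s) ≡ t + suc (x + s)
    regroup = solve-∀

    matches : (s : ℕ) → s < r → mask p d (t + i * L + suc s) ≡ f s
    matches s s<r = begin
      mask p d (t + i * L + suc s)                       ≡⟨ cong (mask p d) (+-suc (t + i * L) s) ⟩
      flipIf (p (t + i * L + s)) (d (suc (t + i * L + s)))
        ≡⟨ cong₂ flipIf (periodic-∣ s aligned) (cong d (regroup t (i * L) s)) ⟩
      flipIf (p s) (d (t + suc (i * L + s)))             ≡⟨ cong (flipIf (p s)) (proj₂ (univ (suc M * L) W) (i * L + s) (inside s s<r)) ⟩
      flipIf (p s) (W (i * L + s))                       ≡⟨ cong (flipIf (p s)) (W-copy s s<r) ⟩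
      flipIf (p s) (flipIf (p s) (f s))                  ≡⟨ flipIf-involutive (p s) (f s) ⟩
      f s                                                ∎
      where open ≡-Reasoning

  mask-universal : ∀ d → Universal d → Universal (mask p d)
  mask-universal d = Universalᶠ⇒Universal (mask p d) ∘ mask-universalᶠ d ∘ Universal⇒Universalᶠ d

  mask-universal⇔ : ∀ d → Universal d ⇔ Universal (mask p d)
  mask-universal⇔ d = mk⇔ (mask-universal d)
    (Universal-resp (mask-involutive p d) ∘ mask-universal (mask p d))

flipPattern : (m' : ℕ) → .{{NonZero m'}} → ℕ → Bool
flipPattern m' k = even (k / m')

T-is-mask : (m' : ℕ) → .{{_ : NonZero m'}} → ∀ d k → T m' d k ≡ mask (flipPattern m') d k
T-is-mask m' d zero    = refl
T-is-mask m' d (suc k) = refl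

even-+2 : ∀ n → even (n + 2) ≡ even n
even-+2 n = trans (cong even (+-comm n 2)) (not-involutive (even n))

flipPattern-periodic : (m' : ℕ) → .{{_ : NonZero m'}} → ∀ k → flipPattern m' (k + 2 * m') ≡ flipPattern m' k
flipPattern-periodic m' k = trans (cong even quotient-shift) (even-+2 (k / m'))
  where
  quotient-shift : (k + 2 * m') / m' ≡ k / m' + 2
  quotient-shift = trans (+-distrib-/-∣ʳ k (n∣m*n 2)) (cong (k / m' +_) (m*n/n≡m 2 m'))

lemma3p1 : (m' : ℕ) → .{{_ : NonZero m'}} → (d : Seq) → Universal d ⇔ Universal (T m' d)
lemma3p1 m' d = mk⇔
  (Universal-resp (sym ∘ T-is-mask m' d) ∘ Equivalence.to masked)
  (Equivalence.from masked ∘ Universal-resp (T-is-mask m' d))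
  where
  instance
    period≢0 : NonZero (2 * m')
    period≢0 = m*n≢0 2 m'

  masked : Universal d ⇔ Universal (mask (flipPattern m') d)
  masked = PeriodicMask.mask-universal⇔ (2 * m') (flipPattern m') (flipPattern-periodic m') d
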